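{- Let $\chi$ be an uncountable cardinal and $\mathbb{P}=\mathrm{Add}(\omega,\chi)$. Suppose $n$ is a positive integer, $H$ is a set of ordinals, and $\langle p_b\mid b\in[H]^n\rangle$ is a sequence of conditions in $\mathbb{P}$ such that there is a fixed $\bar{p}$ with $\bar{p}_b=\bar{p}$ for all $b\in[H]^n$, and $\langle u(p_b)\mid b\in[H]^n\rangle$ is a uniform $n$-dimensional $\Delta$-system. Then for all $a,a'\in[H]^n$, if $a$ and $a'$ are aligned, then $p_a$ and $p_{a'}$ are compatible in $\mathbb{P}$.
   Context: $\mathrm{Add}(\omega,\chi)$ consists of finite partial functions from $\chi\times\omega$ to $\omega$, ordered by reverse inclusion. For $p\in\mathbb{P}$, $u(p)=\{\alpha<\chi\mid\mathrm{dom}(p)\cap(\{\alpha\}\times\omega)\neq\emptyset\}$, and $\bar{p}$ is the finite partial function on $\mathrm{otp}(u(p))\times\omega$ with $(i,j)\in\mathrm{dom}(\bar p)$ iff $(u(p)(i),j)\in\mathrm{dom}(p)$, and then $\bar{p}(i,j)=p(u(p)(i),j)$ (here $u(p)(i)$ is the $i$-th element of $u(p)$ in increasing order). Finite sets of ordinals are identified with increasing enumerations; for a set of ordinals $a$, $a(\ell)$ is its $\ell$-th element and $a[\mathbf{m}]=\{a(\ell)\mid\ell\in\mathbf{m}\}$; $n=\{0,\dots,n-1\}$. Sets of ordinals $a,b$ are aligned if $\mathrm{otp}(a)=\mathrm{otp}(b)$ and $\mathrm{otp}(a\cap\gamma)=\mathrm{otp}(b\cap\gamma)$ for all $\gamma\in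 a\cap b$; then $\mathbf{r}(a,b)=\{i\mid a(i)=b(i)\}$. A family $\langle u_b\mid b\in[H]^n\rangle$ is a uniform $n$-dimensional $\Delta$-system if there are an ordinal $\rho$ and $\mathbf{r}_{\mathbf{m}}\subseteq\rho$ ($\mathbf{m}\subseteq n$) with: $\mathrm{otp}(u_b)=\rho$ for all $b$; whenever $a,b\in[H]^n$ are aligned with $\mathbf{r}(a,b)=\mathbf{m}$, $u_a,u_b$ are aligned with $\mathbf{r}(u_a,u_b)=\mathbf{r}_{\mathbf{m}}$; and $\mathbf{r}_{\mathbf{m}_0\cap\mathbf{m}_1}=\mathbf{r}_{\mathbf{m}_0}\cap\mathbf{r}_{\mathbf{m}_1}$. -}

module Defs where

open import Data.Nat using (ℕ; _<_)
open import Data.Fin using (Fin; toℕ)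
open import Data.Fin.Subset using (Subset; _∩_) renaming (_∈_ to _∈ₛ_)
open import Data.Vec using (Vec; lookup)
open import Data.List using (List)
open import Data.List.Membership.Propositional using (_∈_)
open import Data.Product using (Σ; ∃; _×_; _,_; proj₁)
open import Relation.Binary.PropositionalEquality using (_≡_)
open import Relation.Nullary using (¬_)

_⟺_ : Set → Set → Set
P ⟺ Q = (P → Q) × (Q → P)

-- Everything is relative to an ambient class of ordinals, modelled as a type A
-- with a strict order _≺_ (assumed in the statement to be a well-founded strict
-- total order w.r.t. _≡_, i.e. a well-order; every well-order is an ordinal).
module Ordinals {A : Set} (_≺_ : A → A → Set) where

  Below : A → Set
  Below χ = Σ A (λ α → α ≺ χ)

  IsCardinal : A → Set
  IsCardinal χ = ∀ β → β ≺ χ →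
    ¬ (Σ (Below χ → Below β) λ f →
         ∀ x y → proj₁ (f x) ≡ proj₁ (f y) → proj₁ x ≡ proj₁ y)

  Uncountable : A → Set
  Uncountable χ = ¬ (Σ (ℕ → A) λ g → ∀ α → α ≺ χ → ∃ λ k → g k ≡ α)

  -- Conditions of Add(ω,χ): finite partial functions χ×ω → ω, given by
  -- their (finite) graph.
  record Cond (χ : A) : Set where
    field
      graph      : List ((A × ℕ) × ℕ)
      functional : ∀ x v w → (x , v) ∈ graph → (x , w) ∈ graph → v ≡ w
      bounded    : ∀ α j v → ((α , j) , v) ∈ graph → α ≺ χ
  open Cond public

  _≤ᴾ_ : ∀ {χ} → Cond χ → Cond χ → Set
  q ≤ᴾ p = ∀ x → x ∈ graph p → x ∈ graph q

  Compatible : ∀ {χ} → Cond χ → Cond χ → Set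
  Compatible {χ} p q = Σ (Cond χ) λ r → (r ≤ᴾ p) × (r ≤ᴾ q)

  u : ∀ {χ} → Cond χ → A → Set
  u p α = Σ ℕ λ j → Σ ℕ λ v → ((α , j) , v) ∈ graph p

  -- e : Fin k → A is the increasing enumeration of the set S (so otp(S) = k)
  Increasing : ∀ {k} → (Fin k → A) → Set
  Increasing {k} e = ∀ (i j : Fin k) → toℕ i < toℕ j → e i ≺ e j

  IsEnum : ∀ {k} → (Fin k → A) → (A → Set) → Set
  IsEnum {k} e S = Increasing e × (∀ α → S α ⟺ (∃ λ (i : Fin k) → e i ≡ α))

  -- p̄ computed from p via the increasing enumeration e of u(p):
  -- q is (the graph of) p̄, a finite partial function on otp(u(p)) × ω.
  CollapseIs : ∀ {χ k} → (Fin k → A) → Cond χ → List ((ℕ × ℕ) × ℕ) → Set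
  CollapseIs {k = k} e p q =
    (∀ (i : Fin k) j v → (((e i , j) , v) ∈ graph p) ⟺ (((toℕ i , j) , v) ∈ q))
    × (∀ i j v → ((i , j) , v) ∈ q → i < k)

  Aligned : ∀ {k} → (Fin k → A) → (Fin k → A) → Set
  Aligned {k} a b = ∀ (i j : Fin k) → a i ≡ b j → i ≡ j

  RIs : ∀ {k} → (Fin k → A) → (Fin k → A) → Subset k → Set
  RIs {k} a b m = ∀ (i : Fin k) → (i ∈ₛ m) ⟺ (a i ≡ b i)

  -- b ∈ [H]^n  (n-element subsets identified with increasing vectors)
  InBracket : (H : A → Set) (n : ℕ) → Vec A n → Set
  InBracket H n b = Increasing (lookup b) × (∀ i → H (lookup b i))

  UniformΔ : (H : A → Set) (n : ℕ) → (Vec A n → A → Set) → Set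
  UniformΔ H n U =
    Σ ℕ λ ρ →
    Σ (Vec A n → Fin ρ → A) λ e →
    Σ (Subset n → Subset ρ) λ r →
      (∀ b → InBracket H n b → IsEnum (e b) (U b))
      × (∀ a b → InBracket H n a → InBracket H n b →
           Aligned (lookup a) (lookup b) → ∀ m → RIs (lookup a) (lookup b) m →
           Aligned (e a) (e b) × RIs (e a) (e b) (r m))
      × (∀ m₀ m₁ → r (m₀ ∩ m₁) ≡ r m₀ ∩ r m₁)

-- Since a and a' are aligned, so are u(p_a) and u(p_a'), by uniformity of the
-- Δ-system applied to m = r(a,a').  An ordinal α common to both supports thus
-- sits at the same position i of both increasing enumerations, and since p_a and
-- p_a' collapse to the same p̄, both send (α, j) to p̄(i, j).  Hence p_a and p_a'
-- agree on their common domain, and their union is a common extension.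
module Submission where

open import Defs
open import Data.Nat using (ℕ; _<_)
open import Data.Fin using (Fin; toℕ)
open import Data.Fin.Subset using (Subset) renaming (_∈_ to _∈ₛ_)
open import Data.Vec using (Vec; lookup; tabulate)
open import Data.Vec.Properties using (lookup∘tabulate; []=⇒lookup; lookup⇒[]=)
open import Data.List using (List; _++_)
open import Data.List.Membership.Propositional using (_∈_)
open import Data.List.Membership.Propositional.Properties using (∈-++⁻; ∈-++⁺ˡ; ∈-++⁺ʳ)
open import Data.Product using (Σ; _×_; _,_; proj₁; proj₂)
open import Data.Sum using (inj₁; inj₂)
open import Data.Bool using (true)
open import Relation.Nullary using (Dec; yes; no; does)
open import Relation.Nullary.Decidable using (dec-true)
open import Relation.Binary.Definitions using (DecidableEquality)
open import Relation.Binary.PropositionalEquality using (_≡_; refl; sym; trans; subst)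
open import Relation.Binary.Structures using (IsStrictTotalOrder)
open import Induction.WellFounded using (WellFounded)

does-true⇒ : ∀ {P : Set} (P? : Dec P) → does P? ≡ true → P
does-true⇒ (yes p) _ = p
does-true⇒ (no _) ()

module _ {A : Set} (_≺_ : A → A → Set) where
  open Ordinals _≺_

  agreementSet : DecidableEquality A → ∀ {k} → (Fin k → A) → (Fin k → A) → Subset k
  agreementSet _≟_ a b = tabulate λ i → does (a i ≟ b i)

  RIs-agreementSet : (_≟_ : DecidableEquality A) → ∀ {k} (a b : Fin k → A) →
    RIs a b (agreementSet _≟_ a b)
  RIs-agreementSet _≟_ a b i =
      (λ i∈m → does-true⇒ (a i ≟ b i)
                 (trans (sym (lookup∘tabulate _ i)) ([]=⇒lookup i∈m)))
    , (λ ai≡bi → lookup⇒[]= i _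
                   (trans (lookup∘tabulate _ i) (dec-true (a i ≟ b i) ai≡bi)))

  AgreeOnCommonDomain : ∀ {χ} → Cond χ → Cond χ → Set
  AgreeOnCommonDomain p q = ∀ x v w → (x , v) ∈ graph p → (x , w) ∈ graph q → v ≡ w

  union : ∀ {χ} (p q : Cond χ) → AgreeOnCommonDomain p q → Cond χ
  union {χ} p q agree = record
    { graph      = graph p ++ graph q
    ; functional = functional-++
    ; bounded    = bounded-++
    }
    where
    functional-++ : ∀ x v w → (x , v) ∈ graph p ++ graph q → (x , w) ∈ graph p ++ graph q → v ≡ w
    functional-++ x v w xv xw with ∈-++⁻ (graph p) xv | ∈-++⁻ (graph p) xw
    ... | inj₁ xv∈p | inj₁ xw∈p = functional p x v w xv∈p xw∈p
    ... | inj₁ xv∈p | inj₂ xw∈q = agree x v w xv∈p xw∈q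
    ... | inj₂ xv∈q | inj₁ xw∈p = sym (agree x w v xw∈p xv∈q)
    ... | inj₂ xv∈q | inj₂ xw∈q = functional q x v w xv∈q xw∈q

    bounded-++ : ∀ α j v → ((α , j) , v) ∈ graph p ++ graph q → α ≺ χ
    bounded-++ α j v αjv with ∈-++⁻ (graph p) αjv
    ... | inj₁ αjv∈p = bounded p α j v αjv∈p
    ... | inj₂ αjv∈q = bounded q α j v αjv∈q

  agree⇒compatible : ∀ {χ} {p q : Cond χ} → AgreeOnCommonDomain p q → Compatible p q
  agree⇒compatible {p = p} {q} agree =
    union p q agree , (λ _ → ∈-++⁺ˡ) , (λ _ → ∈-++⁺ʳ (graph p))

  sameCollapse⇒agree : ∀ {χ k} {p q : Cond χ} {e e' : Fin k → A} {pbar} →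
    IsEnum e (u p) → IsEnum e' (u q) →
    CollapseIs e p pbar → CollapseIs e' q pbar →
    Aligned e e' → AgreeOnCommonDomain p q
  sameCollapse⇒agree {p = p} {q} {pbar = pbar} enum enum' collapse collapse' e≈e'
                     (α , j) v w αjv∈p αjw∈q
    with proj₁ (proj₂ enum α) (j , v , αjv∈p) | proj₁ (proj₂ enum' α) (j , w , αjw∈q)
  ... | i , ei≡α | i' , e'i'≡α with e≈e' i i' (trans ei≡α (sym e'i'≡α))
  ... | refl = functional q (α , j) v w αjv∈q αjw∈q
    where
    ijv∈pbar : ((toℕ i , j) , v) ∈ pbar
    ijv∈pbar = proj₁ (proj₁ collapse i j v) (subst (λ β → ((β , j) , v) ∈ graph p) (sym ei≡α) αjv∈p)

    αjv∈q : ((α , j) , v) ∈ graph q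
    αjv∈q = subst (λ β → ((β , j) , v) ∈ graph q) e'i'≡α (proj₂ (proj₁ collapse' i j v) ijv∈pbar)

lemma2p6 : (A : Set) (_≺_ : A → A → Set) →
    IsStrictTotalOrder _≡_ _≺_ → WellFounded _≺_ →
    let open Ordinals _≺_ in
    (χ : A) → IsCardinal χ → Uncountable χ →
    (n : ℕ) → 0 < n → (H : A → Set) → (p : Vec A n → Cond χ) →
    (Σ (List ((ℕ × ℕ) × ℕ)) λ pbar →
    ∀ b → InBracket H n b →
    ∀ k (e : Fin k → A) → IsEnum e (u (p b)) → CollapseIs e (p b) pbar) →
    UniformΔ H n (λ b → u (p b)) →
    ∀ a a' → InBracket H n a → InBracket H n a' →
    Aligned (lookup a) (lookup a') → Compatible (p a) (p a')
lemma2p6 _ _≺_ sto _ _ _ _ _ _ _ p (_ , collapse) (ρ , e , _ , enum , uniform , _)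
         a a' Ha Ha' a≈a' =
  agree⇒compatible _≺_ {p = p a} {p a'}
    (sameCollapse⇒agree _≺_ {p = p a} {p a'} (enum a Ha) (enum a' Ha')
      (collapse a Ha ρ (e a) (enum a Ha)) (collapse a' Ha' ρ (e a') (enum a' Ha'))
      ea≈ea')
  where
  _≟_ = IsStrictTotalOrder._≟_ sto

  ea≈ea' : Ordinals.Aligned _≺_ (e a) (e a')
  ea≈ea' = proj₁ (uniform a a' Ha Ha' a≈a' _
                   (RIs-agreementSet _≺_ _≟_ (lookup a) (lookup a')))
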